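{- Let $n\ge3$, $k\in\mathbb{Z}_{\ge0}$, and let $\mathbf w=[w_1,w_2,\dots]$ be any infinite sequence in $\{1,\dots,n\}$ with $w_{t+1}\ne w_t$ for all $t$. Let ${}_0x\in\mathbb{Z}_{>0}^n$ and ${}_0y\in\mathbb{Z}_{\ge0}^n$, and define ${}_{t+1}x=\mathcal M_{w_{t+1};0}({}_tx)$ and ${}_{t+1}y=\mathcal M_{w_{t+1};k}({}_ty)$ for $t\ge0$. Let ${}_tl_j={}_ty_j/{}_tx_j$ and, for $t\ge1$, $\mathfrak l_t={}_tl_{w_t}$. Then the sequence $(\mathfrak l_t)_{t\ge1}$ is bounded.
   Context: For $k\ge 0$ and $i\in\{1,\dots,n\}$, $\mathcal M_{i;k}(z_1,\dots,z_n)$ is obtained from $(z_1,\dots,z_n)$ by replacing $z_i$ with $z_1+\cdots+\widehat{z_i}+\cdots+z_n+k$ (omitting $z_i$ from the sum) and keeping the other coordinates. -}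

module Defs where

open import Data.Nat using (ℕ; zero; suc; _+_)
open import Data.Fin using (Fin; _≟_)
open import Data.Bool using (if_then_else_)
open import Data.Integer using (+_)
open import Data.Rational using (ℚ; 0ℚ; _/_)
open import Data.Vec.Functional using (Vector; foldr)
open import Relation.Nullary.Decidable using (⌊_⌋)

sumExcept : ∀ {n} → Fin n → Vector ℕ n → ℕ
sumExcept i z = foldr _+_ 0 (λ j → if ⌊ j ≟ i ⌋ then 0 else z j)

mutation : ∀ {n} → Fin n → ℕ → Vector ℕ n → Vector ℕ n
mutation i k z j = if ⌊ j ≟ i ⌋ then sumExcept i z + k else z j

-- orbit w k z₀ t = ₜz, with ₀z = z₀ and ₜ₊₁z = 𝓜_{w(t+1);k}(ₜz).
-- (w 0 is never used; the sequence w is indexed from 1 as in the paper.)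
orbit : ∀ {n} → (ℕ → Fin n) → ℕ → Vector ℕ n → ℕ → Vector ℕ n
orbit w k z₀ zero = z₀
orbit w k z₀ (suc t) = mutation (w (suc t)) k (orbit w k z₀ t)

-- y / x as a rational number (x = 0 never occurs in the theorem; set to 0 then).
ratio : ℕ → ℕ → ℚ
ratio y zero = 0ℚ
ratio y (suc m) = (+ y) / suc m

{-# OPTIONS --safe #-}
module Submission where

-- Fix C = Σⱼ ₀yⱼ + k.  The invariant  ₜyⱼ + k ≤ C · ₜxⱼ  for every coordinate j
-- holds at t = 0 because ₀xⱼ ≥ 1, and it survives every mutation once n ≥ 3:
-- the mutated coordinate becomes Σ_{j≠i} yⱼ + k on top and Σ_{j≠i} xⱼ below,
-- and summing the invariant over the n - 1 ≥ 2 other coordinates yields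
-- Σ_{j≠i} yⱼ + 2k ≤ C · Σ_{j≠i} xⱼ.  Hence every ratio ₜyⱼ / ₜxⱼ is at most C.

open import Defs
open import Data.Nat using (ℕ; zero; suc; _+_; _*_; _≤_; _<_; s≤s; >-nonZero)
open import Data.Nat.Properties
  using (+-*-semiring; +-assoc; +-identityʳ; *-identityʳ; +-mono-≤; +-monoˡ-≤; +-monoʳ-≤;
         m≤m+n; m≤m*n; ≤-refl; ≤-trans; module ≤-Reasoning)
open import Data.Fin using (Fin; zero; suc; _≟_; punchIn)
open import Data.Fin.Properties using (punchInᵢ≢i)
open import Data.Bool using (if_then_else_)
open import Data.Vec.Functional using (Vector; replicate; removeAt)
open import Algebra.Properties.Semiring.Sum +-*-semiring
  using (sum; sum-remove; sum-cong-≗; ∑-distrib-+; *-distribˡ-sum)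
import Data.Integer as ℤ
open import Data.Integer.Properties using (pos-*)
open import Data.Rational using (ℚ; 0ℚ; ∣_∣; _/_; fromℚᵘ) renaming (_≤_ to _≤ℚ_)
open import Data.Rational.Properties
  using (toℚᵘ-cancel-≤; toℚᵘ-fromℚᵘ; 0≤p⇒∣p∣≡p; normalize-nonNeg; nonNegative⁻¹)
  renaming (≤-refl to ≤ℚ-refl)
open import Data.Rational.Unnormalised using (ℚᵘ; mkℚᵘ; *≤*) renaming (_≤_ to _≤ᵘ_)
open import Data.Rational.Unnormalised.Properties using (≤-respˡ-≃; ≤-respʳ-≃; ≃-sym)
open import Data.Product using (∃; _,_)
open import Relation.Binary.PropositionalEquality
open import Relation.Nullary.Decidable using (⌊_⌋; yes; no)
open import Relation.Nullary.Negation using (contradiction)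

sum-replicate≡* : ∀ n k → sum (replicate n k) ≡ n * k
sum-replicate≡* zero    k = refl
sum-replicate≡* (suc n) k = cong (k +_) (sum-replicate≡* n k)

sum-mono-≤ : ∀ {n} {f g : Vector ℕ n} → (∀ j → f j ≤ g j) → sum f ≤ sum g
sum-mono-≤ {zero}  f≤g = ≤-refl
sum-mono-≤ {suc n} f≤g = +-mono-≤ (f≤g zero) (sum-mono-≤ (λ j → f≤g (suc j)))

lookup≤sum : ∀ {n} (z : Vector ℕ n) (j : Fin n) → z j ≤ sum z
lookup≤sum {suc n} z j = subst (z j ≤_) (sym (sum-remove {i = j} z)) (m≤m+n (z j) _)

sumExcept≡sum∘removeAt : ∀ {n} (i : Fin (suc n)) (z : Vector ℕ (suc n)) →
                         sumExcept i z ≡ sum (removeAt z i)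
sumExcept≡sum∘removeAt i z = begin
  sum masked                             ≡⟨ sum-remove {i = i} masked ⟩
  masked i + sum (removeAt masked i)     ≡⟨ cong (_+ sum (removeAt masked i)) masked-i≡0 ⟩
  sum (removeAt masked i)                ≡⟨ sum-cong-≗ masked-off-i ⟩
  sum (removeAt z i)                     ∎
  where
  open ≡-Reasoning
  masked : Vector ℕ _
  masked j = if ⌊ j ≟ i ⌋ then 0 else z j
  masked-off-i : ∀ j → masked (punchIn i j) ≡ z (punchIn i j)
  masked-off-i j with punchIn i j ≟ i
  ... | yes punchIn≡i = contradiction punchIn≡i (punchInᵢ≢i i j)
  ... | no _          = refl
  masked-i≡0 : masked i ≡ 0
  masked-i≡0 with i ≟ i
  ... | yes _   = refl
  ... | no i≢i = contradiction refl i≢i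

Dominated : ∀ {n} → ℕ → ℕ → Vector ℕ n → Vector ℕ n → Set
Dominated k C y x = ∀ j → y j + k ≤ C * x j

module _ {k C : ℕ} where
  open ≤-Reasoning

  sum-dominated : ∀ {n} {y x : Vector ℕ n} → Dominated k C y x → sum y + n * k ≤ C * sum x
  sum-dominated {n} {y} {x} y≼x = begin
    sum y + n * k                    ≡⟨ cong (sum y +_) (sum-replicate≡* n k) ⟨
    sum y + sum (replicate n k)      ≡⟨ ∑-distrib-+ y (replicate n k) ⟨
    sum (λ j → y j + k)              ≤⟨ sum-mono-≤ y≼x ⟩
    sum (λ j → C * x j)              ≡⟨ *-distribˡ-sum C x ⟨
    C * sum x                        ∎

  mutation-dominated : ∀ {n} → 3 ≤ n → (i : Fin n) {y x : Vector ℕ n} →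
                       Dominated k C y x → Dominated k C (mutation i k y) (mutation i 0 x)
  mutation-dominated {suc (suc (suc m))} (s≤s (s≤s (s≤s _))) i {y} {x} y≼x j with j ≟ i
  ... | no _  = y≼x j
  ... | yes _ = begin
    sumExcept i y + k + k                ≡⟨ +-assoc (sumExcept i y) k k ⟩
    sumExcept i y + (k + k)              ≤⟨ +-monoʳ-≤ (sumExcept i y) (+-monoʳ-≤ k (m≤m+n k (m * k))) ⟩
    sumExcept i y + suc (suc m) * k      ≡⟨ cong (_+ suc (suc m) * k) (sumExcept≡sum∘removeAt i y) ⟩
    sum (removeAt y i) + suc (suc m) * k ≤⟨ sum-dominated (λ j → y≼x (punchIn i j)) ⟩
    C * sum (removeAt x i)               ≡⟨ cong (C *_) (sumExcept≡sum∘removeAt i x) ⟨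
    C * sumExcept i x                    ≡⟨ cong (C *_) (+-identityʳ (sumExcept i x)) ⟨
    C * (sumExcept i x + 0)              ∎

  orbit-dominated : ∀ {n} → 3 ≤ n → (w : ℕ → Fin n) {y₀ x₀ : Vector ℕ n} →
                    Dominated k C y₀ x₀ → ∀ t → Dominated k C (orbit w k y₀ t) (orbit w 0 x₀ t)
  orbit-dominated 3≤n w y₀≼x₀ zero    = y₀≼x₀
  orbit-dominated 3≤n w y₀≼x₀ (suc t) =
    mutation-dominated 3≤n (w (suc t)) (orbit-dominated 3≤n w y₀≼x₀ t)

initially-dominated : ∀ {n} k {y x : Vector ℕ n} → (∀ j → 0 < x j) → Dominated k (sum y + k) y x
initially-dominated k {y} {x} x>0 j = begin
  y j + k               ≤⟨ +-monoˡ-≤ k (lookup≤sum y j) ⟩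
  sum y + k             ≤⟨ m≤m*n (sum y + k) (x j) {{>-nonZero (x>0 j)}} ⟩
  (sum y + k) * x j     ∎
  where open ≤-Reasoning

fromℚᵘ-mono-≤ : ∀ {p q : ℚᵘ} → p ≤ᵘ q → fromℚᵘ p ≤ℚ fromℚᵘ q
fromℚᵘ-mono-≤ {p} {q} p≤q =
  toℚᵘ-cancel-≤ (≤-respˡ-≃ (≃-sym (toℚᵘ-fromℚᵘ p)) (≤-respʳ-≃ (≃-sym (toℚᵘ-fromℚᵘ q)) p≤q))

ratio-nonNeg : ∀ y x → 0ℚ ≤ℚ ratio y x
ratio-nonNeg y zero    = ≤ℚ-refl
ratio-nonNeg y (suc m) = nonNegative⁻¹ _ {{normalize-nonNeg y (suc m)}}

ratio-≤ : ∀ C {y x} → y ≤ C * x → ratio y x ≤ℚ ℤ.+ C / 1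
ratio-≤ C {x = zero} _ = nonNegative⁻¹ _ {{normalize-nonNeg C 1}}
ratio-≤ C {y} {suc m} y≤Cx = fromℚᵘ-mono-≤ {mkℚᵘ (ℤ.+ y) m} {mkℚᵘ (ℤ.+ C) 0} (*≤* cross-multiplied)
  where
  cross-multiplied : ℤ.+ y ℤ.* ℤ.+ 1 ℤ.≤ ℤ.+ C ℤ.* ℤ.+ suc m
  cross-multiplied = subst₂ ℤ._≤_ (pos-* y 1) (pos-* C (suc m))
    (ℤ.+≤+ (subst (_≤ C * suc m) (sym (*-identityʳ y)) y≤Cx))

∣ratio∣-≤ : ∀ C {y x} → y ≤ C * x → ∣ ratio y x ∣ ≤ℚ ℤ.+ C / 1
∣ratio∣-≤ C {y} {x} y≤Cx = subst (_≤ℚ _) (sym (0≤p⇒∣p∣≡p (ratio-nonNeg y x))) (ratio-≤ C y≤Cx)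

proposition3p5 : (n : ℕ) → 3 ≤ n → (k : ℕ) → (w : ℕ → Fin n)
    → (∀ t → 1 ≤ t → w (suc t) ≢ w t)
    → (x₀ y₀ : Vector ℕ n) → (∀ j → 0 < x₀ j)
    → ∃ λ (B : ℚ) → ∀ t → 1 ≤ t
      → ∣ ratio (orbit w k y₀ t (w t)) (orbit w 0 x₀ t (w t)) ∣ ≤ℚ B
proposition3p5 n 3≤n k w _ x₀ y₀ x₀>0 =
  ℤ.+ C / 1 , λ t _ → ∣ratio∣-≤ C (≤-trans (m≤m+n _ k) (dominated t (w t)))
  where
  C : ℕ
  C = sum y₀ + k
  dominated : ∀ t → Dominated k C (orbit w k y₀ t) (orbit w 0 x₀ t)
  dominated = orbit-dominated {C = C} 3≤n w (initially-dominated k x₀>0)
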